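{- Let $n\geq 4$ and let ${}_{n}w=[n,1,2,\dots,n-4,n-2,n-1,n-3]\in\mathfrak{S}_n$ (i.e. ${}_{n}w(1)=n$, ${}_{n}w(i)=i-1$ for $2\leq i\leq n-3$, ${}_{n}w(n-2)=n-2$, ${}_{n}w(n-1)=n-1$, ${}_{n}w(n)=n-3$). Then the number $r({}_{n}w)$ of reduced words of ${}_{n}w$ (equivalently, the number of vertices of the graph $\mathcal{G}_{{}_{n}w}$ of reduced words of ${}_{n}w$) is $$r({}_{n}w)=\frac{1}{2}\binom{n}{n-2,\,1,\,1}.$$
   Context: $s_i$ is the simple transposition exchanging $i,i+1$; a reduced word of $w$ is a sequence $a_1\cdots a_p$ with $w=s_{a_1}\cdots s_{a_p}$ and $p$ equal to the number of inversions of $w$. The graph $\mathcal{G}_w$ has the reduced words of $w$ as vertices, two being adjacent if one is obtained from the other by a single commutation move (swapping adjacent letters $i,j$ with $|i-j|>1$) or a single braid move (replacing a factor $i(i+1)i$ by $(i+1)i(i+1)$ or vice versa). $\binom{n}{n-2,1,1}=\frac{n!}{(n-2)!}$ is the multinomial coefficient. -}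

module Defs where

open import Data.Nat using (ℕ; zero; suc; _+_; _*_; _∸_; _<_; _≤_; _<?_; _≤?_; _!)
open import Data.Nat.DivMod using (_/_)
open import Data.Nat.Properties using (_≟_; _!≢0; m*n≢0)
open import Data.List using (List; []; _∷_; length; map; filter; concatMap; upTo; applyUpTo; _++_; foldl)
open import Data.List.Properties using (≡-dec)
open import Data.Product using (_×_)
open import Relation.Binary.PropositionalEquality using (_≡_)
open import Relation.Nullary using (Dec; yes; no; ¬_)
open import Relation.Nullary.Decidable using (_×-dec_)
open import Relation.Unary using (Decidable)

-- A permutation of {1,…,n} is represented by its one-line notation
-- [w(1), w(2), …, w(n)] as a list of naturals.

idPerm : ℕ → List ℕ
idPerm n = applyUpTo suc n

-- swap the entries at (1-indexed) positions i and i+1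
swapAt : ℕ → List ℕ → List ℕ
swapAt _ [] = []
swapAt _ (x ∷ []) = x ∷ []
swapAt zero (x ∷ y ∷ xs) = x ∷ y ∷ xs          -- s_0 does not exist; never used
swapAt (suc zero) (x ∷ y ∷ xs) = y ∷ x ∷ xs
swapAt (suc (suc i)) (x ∷ xs) = x ∷ swapAt (suc i) xs

-- Right multiplication by s_i swaps positions i and i+1 of the one-line notation,
-- so we start from the identity and apply swapAt a_1, then a_2, …
wordPerm : ℕ → List ℕ → List ℕ
wordPerm n as = foldl (λ w a → swapAt a w) (idPerm n) as

inv : List ℕ → ℕ
inv [] = 0
inv (x ∷ xs) = length (filter (λ y → y <? x) xs) + inv xs

words : ℕ → ℕ → List (List ℕ)
words n zero = [] ∷ []
words n (suc p) = concatMap (λ a → map (a ∷_) (words n p)) (applyUpTo suc (n ∸ 1))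

IsReducedWord : ℕ → List ℕ → List ℕ → Set
IsReducedWord n w as = (wordPerm n as ≡ w) × (length as ≡ inv w)

isReducedWord? : (n : ℕ) (w : List ℕ) → Decidable (IsReducedWord n w)
isReducedWord? n w as = ≡-dec _≟_ (wordPerm n as) w ×-dec (length as ≟ inv w)

-- r(w): the number of reduced words of w ∈ 𝔖_n
-- (every reduced word has length inv w and letters in 1 … n-1, so
--  enumerating words n (inv w) and filtering counts them all, each once)
r : ℕ → List ℕ → ℕ
r n w = length (filter (isReducedWord? n w) (words n (inv w)))

multinomial3 : ℕ → ℕ → ℕ → ℕ → ℕ
multinomial3 n a b c = (n !) / ((a !) * (b !) * (c !))
  where
  instance
    _ = m*n≢0 (a ! * b !) (c !) {{m*n≢0 (a !) (b !) {{a !≢0}} {{b !≢0}}}} {{c !≢0}}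

nw : ℕ → List ℕ
nw n = n ∷ (applyUpTo suc (n ∸ 4) ++ ((n ∸ 2) ∷ (n ∸ 1) ∷ (n ∸ 3) ∷ []))

-- The last letter of a reduced word of v is a descent i of v (v(i) > v(i+1)), and removing it
-- leaves a reduced word of v s_i, which has one inversion less.  Hence r(v) = Σ_{descents i} r(v s_i),
-- a recursion that no longer refers to n.  For v = [d+4, 1, …, d, q₁+d, q₂+d, q₃+d] the descent at
-- the front gives the same shape for d - 1 (after discarding the fixed point 1), and the other
-- descents lie inside q.  Writing H, G, F for q = 123, 213, 231 this gives H = 1,
-- G(d) = G(d-1) + H(d) = d + 3 and F(d) = F(d-1) + G(d), so 2 F(d) = (d + 4)(d + 3); r(ₙw) = F(n - 4).
module Submission where

open import Defs
open import Data.Bool using (Bool; true; false; if_then_else_; _∧_)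
open import Data.Bool.Properties using (∧-identityʳ)
open import Data.Empty using (⊥-elim)
open import Data.List using (List; []; _∷_; _++_; _∷ʳ_; length; map; filter; concatMap; applyUpTo)
open import Data.List.Properties
  using (≡-dec; foldl-++; length-++; length-map; map-∘; map-++; map-cong; map-injective; ∷-injective)
open import Data.List.Relation.Unary.All as All using (All; []; _∷_)
open import Data.List.Relation.Unary.All.Properties using (map⁺; ++⁺)
open import Data.Nat using (ℕ; zero; suc; _+_; _*_; _∸_; _≤_; _<_; _≮_; z≤n; s≤s; s<s; _<?_; _!; NonZero)
open import Data.Nat.Properties
open import Algebra.Properties.CommutativeSemigroup +-commutativeSemigroup using (interchange; x∙yz≈y∙xz)
open import Data.Nat.DivMod using (m*n/n≡m; /-congˡ)
open import Data.Nat.Tactic.RingSolver using (solve-∀)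
open import Data.Product using (proj₂)
open import Data.Sum using (_⊎_; inj₁; inj₂)
open import Function using (_∘_)
open import Function.Bundles using (mk⇔)
open import Relation.Binary using (_Preserves_⟶_)
open import Relation.Binary.Definitions using (tri<; tri≈; tri>)
open import Relation.Binary.PropositionalEquality
open import Relation.Nullary using (yes; no; does)
open import Relation.Nullary.Decidable using (dec-true; dec-false; does-⇔)
open import Relation.Unary using (Decidable)

variable
  A B : Set

indicator : Bool → ℕ
indicator true  = 1
indicator false = 0

count : (A → Bool) → List A → ℕ
count P []       = 0
count P (x ∷ xs) = indicator (P x) + count P xs

sumBy : (A → ℕ) → List A → ℕ
sumBy f []       = 0
sumBy f (x ∷ xs) = f x + sumBy f xs

length-filter≡count : {P : A → Set} (P? : Decidable P) (xs : List A) →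
                      length (filter P? xs) ≡ count (does ∘ P?) xs
length-filter≡count P? []       = refl
length-filter≡count P? (x ∷ xs) with does (P? x)
... | true  = cong suc (length-filter≡count P? xs)
... | false = length-filter≡count P? xs

count-cong : {P Q : A → Bool} → (∀ x → P x ≡ Q x) → (xs : List A) → count P xs ≡ count Q xs
count-cong P≗Q []       = refl
count-cong P≗Q (x ∷ xs) = cong₂ _+_ (cong indicator (P≗Q x)) (count-cong P≗Q xs)

count-++ : (P : A → Bool) (xs ys : List A) → count P (xs ++ ys) ≡ count P xs + count P ys
count-++ P []       ys = refl
count-++ P (x ∷ xs) ys = trans (cong (indicator (P x) +_) (count-++ P xs ys)) (sym (+-assoc (indicator (P x)) _ _))

count-map : (P : B → Bool) (f : A → B) (xs : List A) → count P (map f xs) ≡ count (P ∘ f) xs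
count-map P f []       = refl
count-map P f (x ∷ xs) = cong (indicator (P (f x)) +_) (count-map P f xs)

count-concatMap : (P : B → Bool) (f : A → List B) (xs : List A) →
                  count P (concatMap f xs) ≡ sumBy (count P ∘ f) xs
count-concatMap P f []       = refl
count-concatMap P f (x ∷ xs) =
  trans (count-++ P (f x) (concatMap f xs)) (cong (count P (f x) +_) (count-concatMap P f xs))

sumBy-cong : {f g : A → ℕ} → (∀ x → f x ≡ g x) → (xs : List A) → sumBy f xs ≡ sumBy g xs
sumBy-cong f≗g []       = refl
sumBy-cong f≗g (x ∷ xs) = cong₂ _+_ (f≗g x) (sumBy-cong f≗g xs)

sumBy-zero : {f : A → ℕ} → (∀ x → f x ≡ 0) → (xs : List A) → sumBy f xs ≡ 0
sumBy-zero f≗0 []       = refl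
sumBy-zero f≗0 (x ∷ xs) = cong₂ _+_ (f≗0 x) (sumBy-zero f≗0 xs)

sumBy-map : (f : B → ℕ) (g : A → B) (xs : List A) → sumBy f (map g xs) ≡ sumBy (f ∘ g) xs
sumBy-map f g []       = refl
sumBy-map f g (x ∷ xs) = cong (f (g x) +_) (sumBy-map f g xs)

sumBy-+ : (f g : A → ℕ) (xs : List A) → sumBy (λ x → f x + g x) xs ≡ sumBy f xs + sumBy g xs
sumBy-+ f g []       = refl
sumBy-+ f g (x ∷ xs) = trans (cong (f x + g x +_) (sumBy-+ f g xs)) (interchange (f x) (g x) _ _)

sumBy-comm : (h : A → B → ℕ) (xs : List A) (ys : List B) →
             sumBy (λ x → sumBy (h x) ys) xs ≡ sumBy (λ y → sumBy (λ x → h x y) xs) ys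
sumBy-comm h []       ys = sym (sumBy-zero (λ _ → refl) ys)
sumBy-comm h (x ∷ xs) ys =
  trans (cong (sumBy (h x) ys +_) (sumBy-comm h xs ys))
        (sym (sumBy-+ (h x) (λ y → sumBy (λ x → h x y) xs) ys))

letters : ℕ → List ℕ
letters n = applyUpTo suc (n ∸ 1)

count-words-suc : ∀ n p (P : List ℕ → Bool) →
                  count P (words n (suc p)) ≡ sumBy (λ a → count (P ∘ (a ∷_)) (words n p)) (letters n)
count-words-suc n p P = trans (count-concatMap P _ (letters n))
                              (sumBy-cong (λ a → count-map P (a ∷_) (words n p)) (letters n))

-- Splitting off the first letter and reversing the order of summation splits off the last one.
count-words-∷ʳ : ∀ n p (P : List ℕ → Bool) →
                 count P (words n (suc p)) ≡ sumBy (λ a → count (λ as → P (as ∷ʳ a)) (words n p)) (letters n)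
count-words-∷ʳ n zero    P = count-words-suc n zero P
count-words-∷ʳ n (suc p) P = begin
  count P (words n (suc (suc p)))
    ≡⟨ count-words-suc n (suc p) P ⟩
  sumBy (λ b → count (P ∘ (b ∷_)) (words n (suc p))) (letters n)
    ≡⟨ sumBy-cong (λ b → count-words-∷ʳ n p (P ∘ (b ∷_))) (letters n) ⟩
  sumBy (λ b → sumBy (λ a → count (λ as → P (b ∷ as ∷ʳ a)) (words n p)) (letters n)) (letters n)
    ≡⟨ sumBy-comm (λ b a → count (λ as → P (b ∷ as ∷ʳ a)) (words n p)) (letters n) (letters n) ⟩
  sumBy (λ a → sumBy (λ b → count (λ as → P (b ∷ as ∷ʳ a)) (words n p)) (letters n)) (letters n)
    ≡⟨ sumBy-cong (λ a → sym (count-words-suc n p (λ as → P (as ∷ʳ a)))) (letters n) ⟩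
  sumBy (λ a → count (λ as → P (as ∷ʳ a)) (words n (suc p))) (letters n) ∎
  where open ≡-Reasoning

count-words-cong : ∀ n p {P Q : List ℕ → Bool} → (∀ as → length as ≡ p → P as ≡ Q as) →
                   count P (words n p) ≡ count Q (words n p)
count-words-cong n zero    P≗Q = cong (_+ 0) (cong indicator (P≗Q [] refl))
count-words-cong n (suc p) P≗Q =
  trans (count-words-suc n p _)
        (trans (sumBy-cong (λ a → count-words-cong n p (λ as ∣as∣≡p → P≗Q (a ∷ as) (cong suc ∣as∣≡p)))
                           (letters n))
               (sym (count-words-suc n p _)))

range : ℕ → ℕ → List ℕ
range s zero    = []
range s (suc k) = s ∷ range (suc s) k

applyUpTo≡range : ∀ {f : ℕ → ℕ} s k → (∀ i → f i ≡ s + i) → applyUpTo f k ≡ range s k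
applyUpTo≡range s zero    f≗s+ = refl
applyUpTo≡range s (suc k) f≗s+ =
  cong₂ _∷_ (trans (f≗s+ 0) (+-identityʳ s))
            (applyUpTo≡range (suc s) k (λ i → trans (f≗s+ (suc i)) (+-suc s i)))

applyUpTo-suc≡range : ∀ k → applyUpTo suc k ≡ range 1 k
applyUpTo-suc≡range k = applyUpTo≡range 1 k (λ _ → refl)

map-suc-range : ∀ s k → map suc (range s k) ≡ range (suc s) k
map-suc-range s zero    = refl
map-suc-range s (suc k) = cong (suc s ∷_) (map-suc-range (suc s) k)

length-range : ∀ s k → length (range s k) ≡ k
length-range s zero    = refl
length-range s (suc k) = cong suc (length-range (suc s) k)

range-lower : ∀ s k → All (s ≤_) (range s k)
range-lower s zero    = []
range-lower s (suc k) = ≤-refl ∷ All.map (≤-trans (n≤1+n s)) (range-lower (suc s) k)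

range-upper : ∀ s k → All (_< s + k) (range s k)
range-upper s zero    = []
range-upper s (suc k) rewrite +-suc s k = s≤s (m≤m+n s k) ∷ range-upper (suc s) k

swapAt-∷ : ∀ i x l → swapAt (suc (suc i)) (x ∷ l) ≡ x ∷ swapAt (suc i) l
swapAt-∷ i x []      = refl
swapAt-∷ i x (y ∷ l) = refl

swapAt-involutive : ∀ a l → swapAt a (swapAt a l) ≡ l
swapAt-involutive a             []           = refl
swapAt-involutive a             (x ∷ [])     = refl
swapAt-involutive zero          (x ∷ y ∷ xs) = refl
swapAt-involutive (suc zero)    (x ∷ y ∷ xs) = refl
swapAt-involutive (suc (suc i)) (x ∷ y ∷ xs) =
  trans (swapAt-∷ i x (swapAt (suc i) (y ∷ xs))) (cong (x ∷_) (swapAt-involutive (suc i) (y ∷ xs)))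

data Swap (R : ℕ → ℕ → Set) : List ℕ → List ℕ → Set where
  here  : ∀ {x y xs} → R x y → Swap R (x ∷ y ∷ xs) (y ∷ x ∷ xs)
  there : ∀ {x xs ys} → Swap R xs ys → Swap R (x ∷ xs) (x ∷ ys)

Descent Ascent : ℕ → ℕ → Set
Descent x y = y < x
Ascent  x y = y ≮ x

length-Swap : ∀ {R l u} → Swap R l u → length u ≡ length l
length-Swap (here _)  = refl
length-Swap (there s) = cong suc (length-Swap s)

count-Swap : ∀ {R l u} (P : ℕ → Bool) → Swap R l u → count P u ≡ count P l
count-Swap P (here {x} {y} {xs} _) = x∙yz≈y∙xz (indicator (P y)) (indicator (P x)) (count P xs)
count-Swap P (there {x} s)         = cong (indicator (P x) +_) (count-Swap P s)

swapAt-cases : ∀ a l → swapAt a l ≡ l ⊎ Swap Descent l (swapAt a l) ⊎ Swap Ascent l (swapAt a l)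
swapAt-cases a             []           = inj₁ refl
swapAt-cases a             (x ∷ [])     = inj₁ refl
swapAt-cases zero          (x ∷ y ∷ xs) = inj₁ refl
swapAt-cases (suc zero)    (x ∷ y ∷ xs) with y <? x
... | yes y<x = inj₂ (inj₁ (here y<x))
... | no  y≮x = inj₂ (inj₂ (here y≮x))
swapAt-cases (suc (suc i)) (x ∷ y ∷ xs) with swapAt-cases (suc i) (y ∷ xs)
... | inj₁ same          = inj₁ (cong (x ∷_) same)
... | inj₂ (inj₁ desc)   = inj₂ (inj₁ (there desc))
... | inj₂ (inj₂ asc)    = inj₂ (inj₂ (there asc))

below : ℕ → List ℕ → ℕ
below x = count (λ y → does (y <? x))

inv-∷ : ∀ x xs → inv (x ∷ xs) ≡ below x xs + inv xs
inv-∷ x xs = cong (_+ inv xs) (length-filter≡count (_<? x) xs)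

below≡0 : ∀ {x xs} → All (x ≤_) xs → below x xs ≡ 0
below≡0 []                        = refl
below≡0 {x} (_∷_ {y} x≤y x≤ys) rewrite dec-false (y <? x) (≤⇒≯ x≤y) = below≡0 x≤ys

below≡length : ∀ {x xs} → All (_< x) xs → below x xs ≡ length xs
below≡length []                        = refl
below≡length {x} (_∷_ {y} y<x ys<x) rewrite dec-true (y <? x) y<x = cong suc (below≡length ys<x)

inv-∷∷ : ∀ x y xs → inv (x ∷ y ∷ xs) ≡ indicator (does (y <? x)) + below x xs + (below y xs + inv xs)
inv-∷∷ x y xs = trans (inv-∷ x (y ∷ xs)) (cong (below x (y ∷ xs) +_) (inv-∷ y xs))

inv-swap-head : ∀ x y xs →
                inv (y ∷ x ∷ xs) + indicator (does (y <? x)) ≡ inv (x ∷ y ∷ xs) + indicator (does (x <? y))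
inv-swap-head x y xs = begin
  inv (y ∷ x ∷ xs) + [y<x]                            ≡⟨ cong (_+ [y<x]) (inv-∷∷ y x xs) ⟩
  [x<y] + below y xs + (below x xs + inv xs) + [y<x]  ≡⟨ shuffle [x<y] (below y xs) (below x xs) (inv xs) [y<x] ⟩
  [y<x] + below x xs + (below y xs + inv xs) + [x<y]  ≡⟨ cong (_+ [x<y]) (inv-∷∷ x y xs) ⟨
  inv (x ∷ y ∷ xs) + [x<y]                            ∎
  where
  open ≡-Reasoning
  [y<x] [x<y] : ℕ
  [y<x] = indicator (does (y <? x))
  [x<y] = indicator (does (x <? y))
  shuffle : ∀ a b c d e → a + b + (c + d) + e ≡ e + c + (b + d) + a
  shuffle = solve-∀

inv-Swap-descent : ∀ {l u} → Swap Descent l u → inv l ≡ suc (inv u)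
inv-Swap-descent (here {x} {y} {xs} y<x) = begin
  inv (x ∷ y ∷ xs)                                ≡⟨ +-identityʳ _ ⟨
  inv (x ∷ y ∷ xs) + 0
    ≡⟨ cong (λ b → inv (x ∷ y ∷ xs) + indicator b) (dec-false (x <? y) (<⇒≯ y<x)) ⟨
  inv (x ∷ y ∷ xs) + indicator (does (x <? y))    ≡⟨ inv-swap-head x y xs ⟨
  inv (y ∷ x ∷ xs) + indicator (does (y <? x))
    ≡⟨ cong (λ b → inv (y ∷ x ∷ xs) + indicator b) (dec-true (y <? x) y<x) ⟩
  inv (y ∷ x ∷ xs) + 1                            ≡⟨ +-comm (inv (y ∷ x ∷ xs)) 1 ⟩
  suc (inv (y ∷ x ∷ xs))                          ∎
  where open ≡-Reasoning
inv-Swap-descent (there {x} {l} {u} s) = begin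
  inv (x ∷ l)              ≡⟨ inv-∷ x l ⟩
  below x l + inv l        ≡⟨ cong₂ _+_ (sym (count-Swap _ s)) (inv-Swap-descent s) ⟩
  below x u + suc (inv u)  ≡⟨ +-suc (below x u) (inv u) ⟩
  suc (below x u + inv u)  ≡⟨ cong suc (inv-∷ x u) ⟨
  suc (inv (x ∷ u))        ∎
  where open ≡-Reasoning

inv-Swap-ascent : ∀ {l u} → Swap Ascent l u → inv l ≤ inv u
inv-Swap-ascent (here {x} {y} {xs} y≮x) = begin
  inv (x ∷ y ∷ xs)                                ≤⟨ m≤m+n _ _ ⟩
  inv (x ∷ y ∷ xs) + indicator (does (x <? y))    ≡⟨ inv-swap-head x y xs ⟨
  inv (y ∷ x ∷ xs) + indicator (does (y <? x))
    ≡⟨ cong (λ b → inv (y ∷ x ∷ xs) + indicator b) (dec-false (y <? x) y≮x) ⟩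
  inv (y ∷ x ∷ xs) + 0                            ≡⟨ +-identityʳ _ ⟩
  inv (y ∷ x ∷ xs)                                ∎
  where open ≤-Reasoning
inv-Swap-ascent (there {x} {l} {u} s) = begin
  inv (x ∷ l)        ≡⟨ inv-∷ x l ⟩
  below x l + inv l  ≤⟨ +-mono-≤ (≤-reflexive (sym (count-Swap _ s))) (inv-Swap-ascent s) ⟩
  below x u + inv u  ≡⟨ inv-∷ x u ⟨
  inv (x ∷ u)        ∎
  where open ≤-Reasoning

inv-swapAt : ∀ a l → inv l ≤ suc (inv (swapAt a l))
inv-swapAt a l with swapAt a l | swapAt-cases a l
... | _ | inj₁ refl       = n≤1+n (inv l)
... | _ | inj₂ (inj₁ desc) = ≤-reflexive (inv-Swap-descent desc)
... | _ | inj₂ (inj₂ asc)  = m≤n⇒m≤1+n (inv-Swap-ascent asc)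

<-reflected : ∀ {f : ℕ → ℕ} → f Preserves _<_ ⟶ _<_ → ∀ {x y} → f x < f y → x < y
<-reflected {f} mono {x} {y} fx<fy with <-cmp x y
... | tri< x<y _ _ = x<y
... | tri≈ _ refl _ = ⊥-elim (<-irrefl refl fx<fy)
... | tri> _ _ y<x = ⊥-elim (<-asym fx<fy (mono y<x))

does-<?-mono : ∀ {f : ℕ → ℕ} → f Preserves _<_ ⟶ _<_ → ∀ x y → does (f x <? f y) ≡ does (x <? y)
does-<?-mono mono x y = does-⇔ (mk⇔ (<-reflected mono) mono) (_ <? _) (x <? y)

inv-map : ∀ {f : ℕ → ℕ} → f Preserves _<_ ⟶ _<_ → ∀ l → inv (map f l) ≡ inv l
inv-map     mono []      = refl
inv-map {f} mono (x ∷ l) = begin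
  inv (f x ∷ map f l)                 ≡⟨ inv-∷ (f x) (map f l) ⟩
  below (f x) (map f l) + inv (map f l)
    ≡⟨ cong₂ _+_ (trans (count-map _ f l) (count-cong (λ y → does-<?-mono mono y x) l)) (inv-map mono l) ⟩
  below x l + inv l                   ≡⟨ inv-∷ x l ⟨
  inv (x ∷ l)                         ∎
  where open ≡-Reasoning

inv-++ : ∀ {l m} → All (λ x → All (x ≤_) m) l → inv (l ++ m) ≡ inv l + inv m
inv-++             []          = refl
inv-++ {x ∷ l} {m} (x≤m ∷ l≤m) = begin
  inv (x ∷ l ++ m)                        ≡⟨ inv-∷ x (l ++ m) ⟩
  below x (l ++ m) + inv (l ++ m)         ≡⟨ cong₂ _+_ (count-++ _ l m) (inv-++ l≤m) ⟩
  below x l + below x m + (inv l + inv m) ≡⟨ cong (λ t → below x l + t + (inv l + inv m)) (below≡0 x≤m) ⟩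
  below x l + 0 + (inv l + inv m)         ≡⟨ cong (_+ (inv l + inv m)) (+-identityʳ (below x l)) ⟩
  below x l + (inv l + inv m)             ≡⟨ +-assoc (below x l) (inv l) (inv m) ⟨
  below x l + inv l + inv m               ≡⟨ cong (_+ inv m) (inv-∷ x l) ⟨
  inv (x ∷ l) + inv m                     ∎
  where open ≡-Reasoning

inv-range : ∀ s k → inv (range s k) ≡ 0
inv-range s zero    = refl
inv-range s (suc k) = begin
  inv (s ∷ range (suc s) k)                    ≡⟨ inv-∷ s (range (suc s) k) ⟩
  below s (range (suc s) k) + inv (range (suc s) k)
    ≡⟨ cong₂ _+_ (below≡0 (All.map (≤-trans (n≤1+n s)) (range-lower (suc s) k))) (inv-range (suc s) k) ⟩
  0                                            ∎
  where open ≡-Reasoning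

swapSum : (List ℕ → ℕ) → List ℕ → ℕ
swapSum g []           = 0
swapSum g (x ∷ [])     = 0
swapSum g (x ∷ y ∷ xs) = g (y ∷ x ∷ xs) + swapSum (g ∘ (x ∷_)) (y ∷ xs)

ifDescent : ℕ → ℕ → ℕ → ℕ
ifDescent x y t = if does (y <? x) then t else 0

ifDescent-yes : ∀ {x y} t → y < x → ifDescent x y t ≡ t
ifDescent-yes {x} {y} t y<x rewrite dec-true (y <? x) y<x = refl

ifDescent-no : ∀ {x y} t → y ≮ x → ifDescent x y t ≡ 0
ifDescent-no {x} {y} t y≮x rewrite dec-false (y <? x) y≮x = refl

descentSum : (List ℕ → ℕ) → List ℕ → ℕ
descentSum g []           = 0
descentSum g (x ∷ [])     = 0
descentSum g (x ∷ y ∷ xs) = ifDescent x y (g (y ∷ x ∷ xs)) + descentSum (g ∘ (x ∷_)) (y ∷ xs)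

sumBy-swapAt≡swapSum : ∀ g x xs →
                       sumBy (λ a → g (swapAt (suc a) (x ∷ xs))) (range 0 (length xs)) ≡ swapSum g (x ∷ xs)
sumBy-swapAt≡swapSum g x []       = refl
sumBy-swapAt≡swapSum g x (y ∷ ys) = cong (g (y ∷ x ∷ ys) +_) (begin
  sumBy (λ a → g (swapAt (suc a) (x ∷ y ∷ ys))) (range 1 (length ys))
    ≡⟨ cong (sumBy _) (map-suc-range 0 (length ys)) ⟨
  sumBy (λ a → g (swapAt (suc a) (x ∷ y ∷ ys))) (map suc (range 0 (length ys)))
    ≡⟨ sumBy-map _ suc (range 0 (length ys)) ⟩
  sumBy (λ a → g (x ∷ swapAt (suc a) (y ∷ ys))) (range 0 (length ys))
    ≡⟨ sumBy-swapAt≡swapSum (g ∘ (x ∷_)) y ys ⟩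
  swapSum (g ∘ (x ∷_)) (y ∷ ys) ∎)
  where open ≡-Reasoning

swapSum≡descentSum : ∀ g l → (∀ u → Swap Ascent l u → g u ≡ 0) → swapSum g l ≡ descentSum g l
swapSum≡descentSum g []           _      = refl
swapSum≡descentSum g (x ∷ [])     _      = refl
swapSum≡descentSum g (x ∷ y ∷ xs) asc≡0 =
  cong₂ _+_ head (swapSum≡descentSum (g ∘ (x ∷_)) (y ∷ xs) (λ u s → asc≡0 (x ∷ u) (there s)))
  where
  head : g (y ∷ x ∷ xs) ≡ ifDescent x y (g (y ∷ x ∷ xs))
  head with y <? x
  ... | yes y<x = sym (ifDescent-yes _ y<x)
  ... | no  y≮x = trans (asc≡0 (y ∷ x ∷ xs) (here y≮x)) (sym (ifDescent-no _ y≮x))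

descentSum-cong : ∀ {g h} l → (∀ u → Swap Descent l u → g u ≡ h u) → descentSum g l ≡ descentSum h l
descentSum-cong []           _     = refl
descentSum-cong (x ∷ [])     _     = refl
descentSum-cong {g} {h} (x ∷ y ∷ xs) g≗h =
  cong₂ _+_ head (descentSum-cong (y ∷ xs) (λ u s → g≗h (x ∷ u) (there s)))
  where
  head : ifDescent x y (g (y ∷ x ∷ xs)) ≡ ifDescent x y (h (y ∷ x ∷ xs))
  head with y <? x
  ... | yes y<x = cong (ifDescent x y) (g≗h (y ∷ x ∷ xs) (here y<x))
  ... | no  y≮x = trans (ifDescent-no _ y≮x) (sym (ifDescent-no _ y≮x))

descentSum-map : ∀ {f : ℕ → ℕ} → f Preserves _<_ ⟶ _<_ →
                 ∀ g l → descentSum g (map f l) ≡ descentSum (g ∘ map f) l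
descentSum-map     mono g []           = refl
descentSum-map     mono g (x ∷ [])     = refl
descentSum-map {f} mono g (x ∷ y ∷ xs) =
  cong₂ _+_ (cong (λ b → if b then g (f y ∷ f x ∷ map f xs) else 0) (does-<?-mono mono y x))
            (descentSum-map mono (g ∘ (f x ∷_)) (y ∷ xs))

descentSum-++ : ∀ g {l m} → All (λ x → All (x ≤_) m) l →
                descentSum g (l ++ m) ≡ descentSum (λ u → g (u ++ m)) l + descentSum (λ u → g (l ++ u)) m
descentSum-++ g                     []                 = refl
descentSum-++ g {x ∷ []}    {[]}    (_ ∷ [])           = refl
descentSum-++ g {x ∷ []}    {z ∷ m} ((x≤z ∷ _) ∷ [])   =
  cong (_+ descentSum (g ∘ (x ∷_)) (z ∷ m)) (ifDescent-no (g (z ∷ x ∷ m)) (≤⇒≯ x≤z))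
descentSum-++ g {x ∷ y ∷ l} {m}     (_ ∷ y∷l≤m)        =
  trans (cong (ifDescent x y (g (y ∷ x ∷ l ++ m)) +_) (descentSum-++ (g ∘ (x ∷_)) y∷l≤m))
        (sym (+-assoc (ifDescent x y (g (y ∷ x ∷ l ++ m))) _ _))

descentSum-range : ∀ g s k → descentSum g (range s k) ≡ 0
descentSum-range g s zero          = refl
descentSum-range g s (suc zero)    = refl
descentSum-range g s (suc (suc k)) =
  cong₂ _+_ (ifDescent-no _ (n≮n s ∘ <-trans (n<1+n s))) (descentSum-range (g ∘ (s ∷_)) (suc s) (suc k))

_≡ᵇ_ : List ℕ → List ℕ → Bool
u ≡ᵇ v = does (≡-dec _≟_ u v)

swapAt-≡ᵇ : ∀ a u v → swapAt a u ≡ᵇ v ≡ u ≡ᵇ swapAt a v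
swapAt-≡ᵇ a u v = does-⇔ (mk⇔ (λ e → trans (sym (swapAt-involutive a u)) (cong (swapAt a) e))
                                 (λ e → trans (cong (swapAt a) e) (swapAt-involutive a v)))
                         (≡-dec _≟_ _ _) (≡-dec _≟_ _ _)

wordCount : ℕ → List ℕ → ℕ → ℕ
wordCount n v p = count (λ as → wordPerm n as ≡ᵇ v) (words n p)

r≡wordCount : ∀ n w → r n w ≡ wordCount n w (inv w)
r≡wordCount n w = trans (length-filter≡count (isReducedWord? n w) (words n (inv w)))
  (count-words-cong n (inv w) λ as ∣as∣≡inv →
     trans (cong (wordPerm n as ≡ᵇ w ∧_) (dec-true (length as ≟ inv w) ∣as∣≡inv)) (∧-identityʳ _))

wordPerm-∷ʳ : ∀ n as a → wordPerm n (as ∷ʳ a) ≡ swapAt a (wordPerm n as)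
wordPerm-∷ʳ n as a = foldl-++ (λ w a → swapAt a w) (idPerm n) as (a ∷ [])

wordCount-suc : ∀ n v p → wordCount n v (suc p) ≡ sumBy (λ a → wordCount n (swapAt a v) p) (letters n)
wordCount-suc n v p = trans (count-words-∷ʳ n p _) (sumBy-cong (λ a → count-cong (λ as →
  trans (cong (_≡ᵇ v) (wordPerm-∷ʳ n as a)) (swapAt-≡ᵇ a (wordPerm n as) v)) (words n p)) (letters n))

-- Each letter changes inv by at most one, and the empty word gives inv 0.
wordCount-below-inv : ∀ n v p → p < inv v → wordCount n v p ≡ 0
wordCount-below-inv n v zero    0<inv =
  cong (λ b → indicator b + 0) (dec-false (≡-dec _≟_ (idPerm n) v) id≢v)
  where
  id≢v : idPerm n ≢ v
  id≢v refl = <-irrefl (sym (trans (cong inv (applyUpTo-suc≡range n)) (inv-range 1 n))) 0<inv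
wordCount-below-inv n v (suc p) p<inv = trans (wordCount-suc n v p) (sumBy-zero (λ a →
  wordCount-below-inv n (swapAt a v) p (≤-pred (≤-trans p<inv (inv-swapAt a v)))) (letters n))

wordCount-descent : ∀ {n} v p → length v ≡ n → inv v ≡ suc p →
                    wordCount n v (suc p) ≡ descentSum (λ u → wordCount n u p) v
wordCount-descent {n} (x ∷ xs) p refl inv≡ = begin
  wordCount n (x ∷ xs) (suc p)
    ≡⟨ wordCount-suc n (x ∷ xs) p ⟩
  sumBy (λ a → g (swapAt a (x ∷ xs))) (applyUpTo suc (length xs))
    ≡⟨ cong (sumBy _) (trans (applyUpTo-suc≡range (length xs)) (sym (map-suc-range 0 (length xs)))) ⟩
  sumBy (λ a → g (swapAt a (x ∷ xs))) (map suc (range 0 (length xs)))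
    ≡⟨ sumBy-map _ suc (range 0 (length xs)) ⟩
  sumBy (λ a → g (swapAt (suc a) (x ∷ xs))) (range 0 (length xs))
    ≡⟨ sumBy-swapAt≡swapSum g x xs ⟩
  swapSum g (x ∷ xs)
    ≡⟨ swapSum≡descentSum g (x ∷ xs) (λ u asc →
         wordCount-below-inv n u p (subst (_≤ inv u) inv≡ (inv-Swap-ascent asc))) ⟩
  descentSum g (x ∷ xs) ∎
  where
  open ≡-Reasoning
  g : List ℕ → ℕ
  g u = wordCount n u p

-- For a permutation v of 1 … length v this is the number of its reduced words when p = inv v.
reducedCount : List ℕ → ℕ → ℕ
reducedCount v zero    = indicator (range 1 (length v) ≡ᵇ v)
reducedCount v (suc p) = descentSum (λ u → reducedCount u p) v

wordCount≡reducedCount : ∀ {n} v p → length v ≡ n → inv v ≡ p → wordCount n v p ≡ reducedCount v p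
wordCount≡reducedCount v zero    refl _    =
  trans (+-identityʳ _) (cong (λ u → indicator (u ≡ᵇ v)) (applyUpTo-suc≡range (length v)))
wordCount≡reducedCount v (suc p) ∣v∣≡n inv≡ =
  trans (wordCount-descent v p ∣v∣≡n inv≡) (descentSum-cong v λ u desc →
    wordCount≡reducedCount u p (trans (length-Swap desc) ∣v∣≡n)
                               (suc-injective (trans (sym (inv-Swap-descent desc)) inv≡)))

1∷map-suc-≡ᵇ : ∀ u v → (1 ∷ map suc u) ≡ᵇ (1 ∷ map suc v) ≡ u ≡ᵇ v
1∷map-suc-≡ᵇ u v =
  does-⇔ (mk⇔ (map-injective suc-injective ∘ proj₂ ∘ ∷-injective) (cong ((1 ∷_) ∘ map suc)))
         (≡-dec _≟_ (1 ∷ map suc u) (1 ∷ map suc v)) (≡-dec _≟_ u v)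

reducedCount-1∷map-suc : ∀ v p → reducedCount (1 ∷ map suc v) p ≡ reducedCount v p
reducedCount-1∷map-suc v zero    = begin
  indicator (range 1 (suc (length (map suc v))) ≡ᵇ (1 ∷ map suc v))
    ≡⟨ cong (λ k → indicator ((1 ∷ range 2 k) ≡ᵇ (1 ∷ map suc v))) (length-map suc v) ⟩
  indicator ((1 ∷ range 2 (length v)) ≡ᵇ (1 ∷ map suc v))
    ≡⟨ cong (λ l → indicator ((1 ∷ l) ≡ᵇ (1 ∷ map suc v))) (map-suc-range 1 (length v)) ⟨
  indicator ((1 ∷ map suc (range 1 (length v))) ≡ᵇ (1 ∷ map suc v))
    ≡⟨ cong indicator (1∷map-suc-≡ᵇ (range 1 (length v)) v) ⟩
  indicator (range 1 (length v) ≡ᵇ v) ∎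
  where open ≡-Reasoning
reducedCount-1∷map-suc v (suc p) = begin
  descentSum (λ u → reducedCount u p) (1 ∷ map suc v)
    ≡⟨ descentSum-++ (λ u → reducedCount u p) (map⁺ (All.universal (λ _ → s≤s z≤n) v) ∷ []) ⟩
  descentSum (λ u → reducedCount (1 ∷ u) p) (map suc v)
    ≡⟨ descentSum-map s<s (λ u → reducedCount (1 ∷ u) p) v ⟩
  descentSum (λ u → reducedCount (1 ∷ map suc u) p) v
    ≡⟨ descentSum-cong v (λ u _ → reducedCount-1∷map-suc u p) ⟩
  descentSum (λ u → reducedCount u p) v ∎
  where open ≡-Reasoning

wPattern : ℕ → List ℕ → List ℕ
wPattern d q = (4 + d) ∷ range 1 d ++ map (_+ d) q

map-suc-wPattern : ∀ d q → map suc (wPattern d q) ≡ (5 + d) ∷ range 2 d ++ map (_+ suc d) q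
map-suc-wPattern d q = cong ((5 + d) ∷_) (begin
  map suc (range 1 d ++ map (_+ d) q)           ≡⟨ map-++ suc (range 1 d) _ ⟩
  map suc (range 1 d) ++ map suc (map (_+ d) q) ≡⟨ cong₂ _++_ (map-suc-range 1 d) (sym (map-∘ q)) ⟩
  range 2 d ++ map (suc ∘ (_+ d)) q             ≡⟨ cong (range 2 d ++_) (map-cong (λ x → sym (+-suc x d)) q) ⟩
  range 2 d ++ map (_+ suc d) q                 ∎)
  where open ≡-Reasoning

-- The front descent (d+5, 1) moves the fixed point 1 to the front, leaving wPattern d q shifted up;
-- the run 1 … d+1 has no descents and lies below the block q + (d+1).
reducedCount-wPattern-suc : ∀ d q p →
  reducedCount (wPattern (suc d) q) (suc p)
    ≡ reducedCount (wPattern d q) p + descentSum (λ u → reducedCount (wPattern (suc d) u) p) q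
reducedCount-wPattern-suc d q p = cong₂ _+_ front (begin
  descentSum (g ∘ ((5 + d) ∷_)) (range 1 (suc d) ++ map (_+ suc d) q)
    ≡⟨ descentSum-++ (g ∘ ((5 + d) ∷_)) (All.map below-block (range-upper 1 (suc d))) ⟩
  descentSum _ (range 1 (suc d))
    + descentSum (λ u → g ((5 + d) ∷ range 1 (suc d) ++ u)) (map (_+ suc d) q)
    ≡⟨ cong₂ _+_ (descentSum-range _ 1 (suc d)) (descentSum-map (+-monoˡ-< (suc d)) _ q) ⟩
  descentSum (λ u → reducedCount (wPattern (suc d) u) p) q ∎)
  where
  open ≡-Reasoning
  g : List ℕ → ℕ
  g u = reducedCount u p
  front : g (1 ∷ (5 + d) ∷ range 2 d ++ map (_+ suc d) q) ≡ reducedCount (wPattern d q) p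
  front = trans (cong (λ u → g (1 ∷ u)) (sym (map-suc-wPattern d q)))
                (reducedCount-1∷map-suc (wPattern d q) p)
  below-block : ∀ {x} → x < 1 + suc d → All (x ≤_) (map (_+ suc d) q)
  below-block (s≤s x≤sd) = map⁺ (All.universal (λ y → ≤-trans x≤sd (m≤n+m (suc d) y)) q)

reducedCount-wPattern-123 : ∀ d → reducedCount (wPattern d (1 ∷ 2 ∷ 3 ∷ [])) (3 + d) ≡ 1
reducedCount-wPattern-123 zero    = refl
reducedCount-wPattern-123 (suc d) =
  trans (reducedCount-wPattern-suc d _ (3 + d)) (cong (_+ 0) (reducedCount-wPattern-123 d))

reducedCount-wPattern-213 : ∀ d → reducedCount (wPattern d (2 ∷ 1 ∷ 3 ∷ [])) (4 + d) ≡ 3 + d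
reducedCount-wPattern-213 zero    = refl
reducedCount-wPattern-213 (suc d) = begin
  reducedCount (wPattern (suc d) (2 ∷ 1 ∷ 3 ∷ [])) (4 + suc d)
    ≡⟨ reducedCount-wPattern-suc d _ (4 + d) ⟩
  reducedCount (wPattern d (2 ∷ 1 ∷ 3 ∷ [])) (4 + d)
    + (reducedCount (wPattern (suc d) (1 ∷ 2 ∷ 3 ∷ [])) (4 + d) + 0)
    ≡⟨ cong₂ (λ a b → a + (b + 0)) (reducedCount-wPattern-213 d) (reducedCount-wPattern-123 (suc d)) ⟩
  3 + d + 1
    ≡⟨ +-comm (3 + d) 1 ⟩
  3 + suc d ∎
  where open ≡-Reasoning

twice-reducedCount-wPattern-231 : ∀ d →
  2 * reducedCount (wPattern d (2 ∷ 3 ∷ 1 ∷ [])) (5 + d) ≡ (4 + d) * (3 + d)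
twice-reducedCount-wPattern-231 zero    = refl
twice-reducedCount-wPattern-231 (suc d) = begin
  2 * reducedCount (wPattern (suc d) (2 ∷ 3 ∷ 1 ∷ [])) (5 + suc d)
    ≡⟨ cong (2 *_) (reducedCount-wPattern-suc d _ (5 + d)) ⟩
  2 * (F + (reducedCount (wPattern (suc d) (2 ∷ 1 ∷ 3 ∷ [])) (5 + d) + 0))
    ≡⟨ cong (λ b → 2 * (F + (b + 0))) (reducedCount-wPattern-213 (suc d)) ⟩
  2 * (F + (4 + d + 0))
    ≡⟨ *-distribˡ-+ 2 F (4 + d + 0) ⟩
  2 * F + 2 * (4 + d + 0)
    ≡⟨ cong (_+ 2 * (4 + d + 0)) (twice-reducedCount-wPattern-231 d) ⟩
  (4 + d) * (3 + d) + 2 * (4 + d + 0)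
    ≡⟨ step d ⟩
  (5 + d) * (4 + d) ∎
  where
  open ≡-Reasoning
  F : ℕ
  F = reducedCount (wPattern d (2 ∷ 3 ∷ 1 ∷ [])) (5 + d)
  step : ∀ d → (4 + d) * (3 + d) + 2 * (4 + d + 0) ≡ (5 + d) * (4 + d)
  step = solve-∀

inv-wPattern : ∀ d q → All (_< 4) q → inv (wPattern d q) ≡ d + length q + inv q
inv-wPattern d q q<4 = begin
  inv ((4 + d) ∷ rest)                              ≡⟨ inv-∷ (4 + d) rest ⟩
  below (4 + d) rest + inv rest                     ≡⟨ cong₂ _+_ (below≡length rest<4+d) (inv-++ range≤block) ⟩
  length rest + (inv (range 1 d) + inv (map (_+ d) q))
    ≡⟨ cong₂ _+_ (trans (length-++ (range 1 d)) (cong₂ _+_ (length-range 1 d) (length-map _ q)))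
                 (cong₂ _+_ (inv-range 1 d) (inv-map (+-monoˡ-< d) q)) ⟩
  d + length q + inv q                              ∎
  where
  open ≡-Reasoning
  rest : List ℕ
  rest = range 1 d ++ map (_+ d) q
  rest<4+d : All (_< 4 + d) rest
  rest<4+d = ++⁺ (All.map (λ x<1+d → <-≤-trans x<1+d (s≤s (m≤n+m d 3))) (range-upper 1 d))
                 (map⁺ (All.map (+-monoˡ-< d) q<4))
  range≤block : All (λ x → All (x ≤_) (map (_+ d) q)) (range 1 d)
  range≤block =
    All.map (λ { (s≤s x≤d) → map⁺ (All.universal (λ y → ≤-trans x≤d (m≤n+m d y)) q) }) (range-upper 1 d)

nw≡wPattern : ∀ d → nw (4 + d) ≡ wPattern d (2 ∷ 3 ∷ 1 ∷ [])
nw≡wPattern d = cong (λ l → (4 + d) ∷ l ++ (2 + d ∷ 3 + d ∷ 1 + d ∷ [])) (applyUpTo-suc≡range d)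

length-wPattern : ∀ d q → length (wPattern d q) ≡ suc (d + length q)
length-wPattern d q = cong suc (trans (length-++ (range 1 d)) (cong₂ _+_ (length-range 1 d) (length-map _ q)))

multinomial3-pair : ∀ m → multinomial3 (2 + m) m 1 1 ≡ (2 + m) * (1 + m)
multinomial3-pair m =
  trans (/-congˡ {{nonZero}} factorial≡) (m*n/n≡m ((2 + m) * (1 + m)) (m ! * 1 ! * 1 !) {{nonZero}})
  where
  nonZero : NonZero (m ! * 1 ! * 1 !)
  nonZero = m*n≢0 (m ! * 1) 1 {{m*n≢0 (m !) 1 {{m !≢0}}}}
  factorial≡ : (2 + m) ! ≡ (2 + m) * (1 + m) * (m ! * 1 ! * 1 !)
  factorial≡ = trans (sym (*-assoc (2 + m) (1 + m) (m !)))
                     (cong ((2 + m) * (1 + m) *_) (sym (trans (*-identityʳ (m ! * 1)) (*-identityʳ (m !)))))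

theorem3p5 : (n : ℕ) → 4 ≤ n → 2 * r n (nw n) ≡ multinomial3 n (n ∸ 2) 1 1
theorem3p5 (suc (suc (suc (suc d)))) (s≤s (s≤s (s≤s (s≤s z≤n)))) = begin
  2 * r n (nw n)                         ≡⟨ cong (2 *_) (r≡wordCount n (nw n)) ⟩
  2 * wordCount n (nw n) (inv (nw n))    ≡⟨ cong (2 *_) (wordCount≡reducedCount (nw n) _ ∣nw∣≡n refl) ⟩
  2 * reducedCount (nw n) (inv (nw n))   ≡⟨ cong (λ v → 2 * reducedCount v (inv v)) (nw≡wPattern d) ⟩
  2 * reducedCount w (inv w)             ≡⟨ cong (λ p → 2 * reducedCount w p) inv≡ ⟩
  2 * reducedCount w (5 + d)             ≡⟨ twice-reducedCount-wPattern-231 d ⟩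
  (4 + d) * (3 + d)                      ≡⟨ multinomial3-pair (2 + d) ⟨
  multinomial3 n (n ∸ 2) 1 1             ∎
  where
  open ≡-Reasoning
  n : ℕ
  n = 4 + d
  w : List ℕ
  w = wPattern d (2 ∷ 3 ∷ 1 ∷ [])
  ∣nw∣≡n : length (nw n) ≡ n
  ∣nw∣≡n = trans (cong length (nw≡wPattern d)) (trans (length-wPattern d _) (cong suc (+-comm d 3)))
  inv≡ : inv w ≡ 5 + d
  inv≡ = trans (inv-wPattern d _ (s≤s (s≤s (s≤s z≤n)) ∷ ≤-refl ∷ s≤s (s≤s z≤n) ∷ []))
               (trans (+-comm (d + 3) 2) (cong (2 +_) (+-comm d 3)))
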